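{- Let $\mathcal A$ be a restricted matrix interpretation (RMI) for a TRS $\mathcal R$. Let $M$ be the component-wise maximum of all matrices used in the interpretations of constructor symbols of $\mathcal R$, and let $d$ be the number of ones on the diagonal of $M$. Then $\mathcal A$ is of basic degree $d$. Furthermore, if $M$ is the unit matrix then $\mathcal A$ is of basic degree $1$.
   Context: Let $\mathcal R$ be a TRS over signature $\mathcal F$; its defined symbols are the roots of left-hand sides of its rules, the other symbols are constructors. A term $f(t_1,\dots,t_n)$ is basic if $f$ is defined and all $t_i$ are built from constructors and variables. $|t|$ is the number of symbol and variable occurrences in $t$. A matrix interpretation $\mathcal A$ of dimension $k$ assigns to each $n$-ary $f\in\mathcal F$ a map $f_{\mathcal A}(\vec v_1,\dots,\vec v_n)=F_1\vec v_1+\cdots+F_n\vec v_n+\vec f$ with $F_i\in\mathbb N^{k\times k}$, $\vec f\in\mathbb N^k$; $[t]$ denotes the evaluation of $t$ under the assignment mapping all variables to $\vec 0$, and $[t]_j$ its $j$-th component. An upper triangular complexity matrix is $M\in\mathbb N^{k\times k}$ with $M_{j,l}=0$ for $l<j$ and $M_{j,j}\le1$. $\mathcal A$ is an RMI if for every constructor symbol $f$ all matrices $F_1,\dots,F_n$ of $f_{\mathcal A}$ are upper triangular complexity matrices. $\mathcal A$ is of basic degree $d$ if there is a constant $c$ with $[t]_j\le c\cdot|t|^d$ for all basic terms $t$ and all $1\le j\le k$. -}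

module Defs where

open import Data.Nat using (ℕ; zero; suc; _+_; _*_; _^_; _≤_; _<_; _⊔_)
open import Data.Nat.Properties using (_≟_)
open import Data.Fin using (Fin; toℕ) renaming (zero to fz; suc to fs)
import Data.Fin.Properties as FinP
open import Data.List using (List)
open import Data.List.Relation.Unary.Any using (Any; any?)
open import Data.Product using (Σ; ∃; _×_)
open import Relation.Binary.PropositionalEquality using (_≡_)
open import Data.Unit using (⊤)
open import Data.Empty using (⊥)
open import Relation.Nullary using (¬_; Dec; yes; no)

sumFin : (n : ℕ) → (Fin n → ℕ) → ℕ
sumFin zero    g = 0
sumFin (suc n) g = g fz + sumFin n (λ i → g (fs i))

maxFin : (n : ℕ) → (Fin n → ℕ) → ℕ
maxFin zero    g = 0
maxFin (suc n) g = g fz ⊔ maxFin n (λ i → g (fs i))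

record Signature : Set where
  field
    size  : ℕ
    arity : Fin size → ℕ

  Sym : Set
  Sym = Fin size

module Terms (Σs : Signature) where
  open Signature Σs

  data Term : Set where
    var : ℕ → Term
    app : (f : Sym) → (Fin (arity f) → Term) → Term

  _occursIn_ : ℕ → Term → Set
  x occursIn var y    = x ≡ y
  x occursIn app f ts = Σ (Fin (arity f)) (λ i → x occursIn ts i)

  ∣_∣ : Term → ℕ
  ∣ var x ∣    = 1
  ∣ app f ts ∣ = suc (sumFin (arity f) (λ i → ∣ ts i ∣))

  -- rewrite rule l → r: l is not a variable (encoded by giving its root
  -- symbol and arguments) and every variable of r occurs in l
  record Rule : Set where
    field
      lhsSym  : Sym
      lhsArgs : Fin (arity lhsSym) → Term
      rhs     : Term
      varCond : ∀ x → x occursIn rhs → x occursIn app lhsSym lhsArgs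

  lhs : Rule → Term
  lhs ρ = app (Rule.lhsSym ρ) (Rule.lhsArgs ρ)

  TRS : Set
  TRS = List Rule

  module _ (R : TRS) where
    Defined : Sym → Set
    Defined f = Any (λ ρ → Rule.lhsSym ρ ≡ f) R

    Defined? : (f : Sym) → Dec (Defined f)
    Defined? f = any? (λ ρ → Rule.lhsSym ρ FinP.≟ f) R

    Constructor : Sym → Set
    Constructor f = ¬ Defined f

    ConstructorTerm : Term → Set
    ConstructorTerm (var x)    = ⊤
    ConstructorTerm (app f ts) = Constructor f × (∀ i → ConstructorTerm (ts i))

    Basic : Term → Set
    Basic (var x)    = ⊥
    Basic (app f ts) = Defined f × (∀ i → ConstructorTerm (ts i))

Vector : ℕ → Set
Vector k = Fin k → ℕ

Matrix : ℕ → Set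
Matrix k = Fin k → Fin k → ℕ

0ᵥ : ∀ {k} → Vector k
0ᵥ j = 0

_+ᵥ_ : ∀ {k} → Vector k → Vector k → Vector k
(u +ᵥ v) j = u j + v j

_*ᵥ_ : ∀ {k} → Matrix k → Vector k → Vector k
_*ᵥ_ {k} A v j = sumFin k (λ l → A j l * v l)

UTCM : ∀ {k} → Matrix k → Set
UTCM M = (∀ j l → toℕ l < toℕ j → M j l ≡ 0) × (∀ j → M j j ≤ 1)

unitMatrix : ∀ {k} → Matrix k
unitMatrix j l with j FinP.≟ l
... | yes _ = 1
... | no  _ = 0

diagOnes : ∀ {k} → Matrix k → ℕ
diagOnes {k} M = sumFin k (λ j → one? (M j j))
  where
  one? : ℕ → ℕ
  one? n with n ≟ 1
  ... | yes _ = 1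
  ... | no  _ = 0

module Interpretations (Σs : Signature) where
  open Signature Σs
  open Terms Σs

  -- matrix interpretation of dimension k:
  -- f_A(v_1,...,v_n) = F_1 v_1 + ... + F_n v_n + f
  record MatrixInterpretation (k : ℕ) : Set where
    field
      mat : (f : Sym) → Fin (arity f) → Matrix k
      vec : (f : Sym) → Vector k

  module _ {k : ℕ} (𝒜 : MatrixInterpretation k) where
    open MatrixInterpretation 𝒜

    ⟦_⟧ : Term → Vector k
    ⟦ var x ⟧    = 0ᵥ
    ⟦ app f ts ⟧ j = sumFin (arity f) (λ i → (mat f i *ᵥ ⟦ ts i ⟧) j) + vec f j

    module _ (R : TRS) where
      RMI : Set
      RMI = ∀ f → Constructor R f → ∀ i → UTCM (mat f i)

      BasicDegree : ℕ → Set
      BasicDegree d = Σ ℕ λ c → ∀ t → Basic R t → ∀ j → ⟦ t ⟧ j ≤ c * (∣ t ∣ ^ d)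

      -- component-wise maximum of all matrices used for constructor symbols
      -- (the zero matrix if there are none)
      maxConstrMatrix : Matrix k
      maxConstrMatrix j l = maxFin size entry
        where
        entry : Sym → ℕ
        entry f with Defined? R f
        ... | yes _ = 0
        ... | no  _ = maxFin (arity f) (λ i → mat f i j l)

-- Peel off the first coordinate. Because constructor matrices are upper triangular,
-- the remaining coordinates of a constructor term evaluate as under the smaller
-- interpretation, which by induction on the dimension grow like |t|^e with e the
-- number of diagonal ones of the trailing part of M. The first coordinate then
-- satisfies [c(ts)]₀ ≤ M₀₀ · Σᵢ [tsᵢ]₀ + D·|c(ts)|^e: for M₀₀ = 0 this is already
-- a bound of degree e, and for M₀₀ = 1 unfolding the recurrence costs one more
-- factor |t|. A single defined symbol on top of constructor terms changes only the
-- constant. When M is the unit matrix, every coordinate obeys the recurrence with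
-- coefficient 1 on its own, so the bound is linear.
module Submission where

open import Defs
open import Data.Nat using (ℕ; zero; suc; _+_; _*_; _^_; _≤_; z≤n; s≤s; z<s; NonZero)
open import Data.Nat.Properties
open import Data.Nat.Tactic.RingSolver using (solve-∀)
open import Data.Fin using (Fin) renaming (zero to fz; suc to fs)
import Data.Fin.Properties as FinP
open import Data.Product using (Σ; _×_; _,_; proj₁; proj₂)
open import Data.Sum using (_⊎_; inj₁; inj₂)
open import Data.Empty using (⊥-elim)
open import Function using (_∘_)
open import Relation.Nullary using (yes; no)
open import Relation.Binary.PropositionalEquality
  using (_≡_; refl; sym; trans; cong; cong₂; subst; module ≡-Reasoning)

sumFin-cong : ∀ n {g h : Fin n → ℕ} → (∀ i → g i ≡ h i) → sumFin n g ≡ sumFin n h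
sumFin-cong zero    g≡h = refl
sumFin-cong (suc n) g≡h = cong₂ _+_ (g≡h fz) (sumFin-cong n (g≡h ∘ fs))

sumFin-mono : ∀ n {g h : Fin n → ℕ} → (∀ i → g i ≤ h i) → sumFin n g ≤ sumFin n h
sumFin-mono zero    g≤h = z≤n
sumFin-mono (suc n) g≤h = +-mono-≤ (g≤h fz) (sumFin-mono n (g≤h ∘ fs))

sumFin-distrib-+ : ∀ n (g h : Fin n → ℕ) →
                   sumFin n (λ i → g i + h i) ≡ sumFin n g + sumFin n h
sumFin-distrib-+ zero    g h = refl
sumFin-distrib-+ (suc n) g h = begin
  g fz + h fz + sumFin n (λ i → g (fs i) + h (fs i))
    ≡⟨ cong (g fz + h fz +_) (sumFin-distrib-+ n (g ∘ fs) (h ∘ fs)) ⟩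
  g fz + h fz + (sumFin n (g ∘ fs) + sumFin n (h ∘ fs))
    ≡⟨ +-shuffle (g fz) (h fz) _ _ ⟩
  g fz + sumFin n (g ∘ fs) + (h fz + sumFin n (h ∘ fs)) ∎
  where
  open ≡-Reasoning
  +-shuffle : ∀ a b c d → a + b + (c + d) ≡ a + c + (b + d)
  +-shuffle = solve-∀

sumFin-distribˡ-* : ∀ n c (g : Fin n → ℕ) → sumFin n (λ i → c * g i) ≡ c * sumFin n g
sumFin-distribˡ-* zero    c g = sym (*-zeroʳ c)
sumFin-distribˡ-* (suc n) c g =
  trans (cong (c * g fz +_) (sumFin-distribˡ-* n c (g ∘ fs))) (sym (*-distribˡ-+ c _ _))

sumFin-distribʳ-* : ∀ n c (g : Fin n → ℕ) → sumFin n (λ i → g i * c) ≡ sumFin n g * c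
sumFin-distribʳ-* n c g = begin
  sumFin n (λ i → g i * c) ≡⟨ sumFin-cong n (λ i → *-comm (g i) c) ⟩
  sumFin n (λ i → c * g i) ≡⟨ sumFin-distribˡ-* n c g ⟩
  c * sumFin n g           ≡⟨ *-comm c _ ⟩
  sumFin n g * c           ∎
  where open ≡-Reasoning

sumFin-const : ∀ n c → sumFin n (λ _ → c) ≡ n * c
sumFin-const zero    c = refl
sumFin-const (suc n) c = cong (c +_) (sumFin-const n c)

term≤sumFin : ∀ n (g : Fin n → ℕ) i → g i ≤ sumFin n g
term≤sumFin (suc n) g fz     = m≤m+n _ _
term≤sumFin (suc n) g (fs i) = ≤-trans (term≤sumFin n (g ∘ fs) i) (m≤n+m _ _)

sumFin-*-≤ : ∀ n {a b x : Fin n → ℕ} {y} → (∀ l → a l ≤ b l) → (∀ l → x l ≤ y) →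
             sumFin n (λ l → a l * x l) ≤ sumFin n b * y
sumFin-*-≤ n {b = b} {y = y} a≤b x≤y =
  ≤-trans (sumFin-mono n (λ l → *-mono-≤ (a≤b l) (x≤y l))) (≤-reflexive (sumFin-distribʳ-* n y b))

term≤maxFin : ∀ n (g : Fin n → ℕ) i → g i ≤ maxFin n g
term≤maxFin (suc n) g fz     = m≤m⊔n _ _
term≤maxFin (suc n) g (fs i) = ≤-trans (term≤maxFin n (g ∘ fs) i) (m≤n⊔m _ _)

maxFin-lub : ∀ n (g : Fin n → ℕ) b → (∀ i → g i ≤ b) → maxFin n g ≤ b
maxFin-lub zero    g b g≤b = z≤n
maxFin-lub (suc n) g b g≤b = ⊔-lub (g≤b fz) (maxFin-lub n (g ∘ fs) b (g≤b ∘ fs))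

unitMatrix-fs : ∀ {k} (j l : Fin k) → unitMatrix (fs j) (fs l) ≡ unitMatrix j l
unitMatrix-fs j l with j FinP.≟ l
... | yes _ = refl
... | no  _ = refl

unitMatrix-*ᵥ : ∀ {k} (v : Vector k) j → (unitMatrix *ᵥ v) j ≡ v j
unitMatrix-*ᵥ {suc k} v fz = begin
  1 * v fz + sumFin k (λ _ → 0) ≡⟨ cong₂ _+_ (*-identityˡ (v fz)) (sumFin-const k 0) ⟩
  v fz + k * 0                  ≡⟨ cong (v fz +_) (*-zeroʳ k) ⟩
  v fz + 0                      ≡⟨ +-identityʳ (v fz) ⟩
  v fz                          ∎
  where open ≡-Reasoning
unitMatrix-*ᵥ {suc k} v (fs j) = begin
  sumFin k (λ l → unitMatrix (fs j) (fs l) * v (fs l))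
    ≡⟨ sumFin-cong k (λ l → cong (_* v (fs l)) (unitMatrix-fs j l)) ⟩
  (unitMatrix *ᵥ (v ∘ fs)) j
    ≡⟨ unitMatrix-*ᵥ (v ∘ fs) j ⟩
  v (fs j) ∎
  where open ≡-Reasoning

tailMatrix : ∀ {k} → Matrix (suc k) → Matrix k
tailMatrix M j l = M (fs j) (fs l)

UTCM-tail : ∀ {k} {M : Matrix (suc k)} → UTCM M → UTCM (tailMatrix M)
UTCM-tail (lower , diag) = (λ j l l<j → lower (fs j) (fs l) (s≤s l<j)) , (diag ∘ fs)

diagOnes-tail-0 : ∀ {k} (M : Matrix (suc k)) → M fz fz ≡ 0 → diagOnes M ≡ diagOnes (tailMatrix M)
diagOnes-tail-0 M M₀₀≡0 rewrite M₀₀≡0 = refl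

diagOnes-tail-1 : ∀ {k} (M : Matrix (suc k)) → M fz fz ≡ 1 →
                  diagOnes M ≡ suc (diagOnes (tailMatrix M))
diagOnes-tail-1 M M₀₀≡1 rewrite M₀₀≡1 = refl

module _ {Σs : Signature} where
  open Signature Σs
  open Terms Σs

  ∣∣-nonZero : ∀ t → NonZero ∣ t ∣
  ∣∣-nonZero (var x)    = _
  ∣∣-nonZero (app f ts) = _

  ∣arg∣≤∣app∣ : ∀ f ts i → ∣ ts i ∣ ≤ ∣ app f ts ∣
  ∣arg∣≤∣app∣ f ts i = ≤-trans (term≤sumFin (arity f) (∣_∣ ∘ ts) i) (n≤1+n _)

module ConstructorBounds {Σs : Signature} (R : Terms.TRS Σs) where
  open Signature Σs
  open Terms Σs
  open Interpretations Σs
  open MatrixInterpretation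

  maxArity : ℕ
  maxArity = maxFin size arity

  sumFin-arity-const : ∀ f c → sumFin (arity f) (λ _ → c) ≤ maxArity * c
  sumFin-arity-const f c =
    ≤-trans (≤-reflexive (sumFin-const (arity f) c)) (*-monoˡ-≤ c (term≤maxFin size arity f))

  [_]⟦_⟧ : ∀ {k} → MatrixInterpretation k → Term → Vector k
  [ 𝒜 ]⟦ t ⟧ = ⟦_⟧ 𝒜 t

  ConstructorMatrices≤ : ∀ {k} → MatrixInterpretation k → Matrix k → Set
  ConstructorMatrices≤ 𝒜 M = ∀ f → Constructor R f → ∀ i j l → mat 𝒜 f i j l ≤ M j l

  ConstructorDegree : ∀ {k} → MatrixInterpretation k → ℕ → Set
  ConstructorDegree 𝒜 e =
    Σ ℕ λ c → ∀ t → ConstructorTerm R t → ∀ j → [ 𝒜 ]⟦ t ⟧ j ≤ c * ∣ t ∣ ^ e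

  recurrence-bound : (φ : Term → ℕ) (D e : ℕ) → (∀ x → φ (var x) ≡ 0) →
    (∀ c ts → Constructor R c → (∀ i → ConstructorTerm R (ts i)) →
       φ (app c ts) ≤ sumFin (arity c) (φ ∘ ts) + D * ∣ app c ts ∣ ^ e) →
    ∀ t → ConstructorTerm R t → φ t ≤ D * ∣ t ∣ ^ suc e
  recurrence-bound φ D e φ-var φ-app (var x) _ = ≤-trans (≤-reflexive (φ-var x)) z≤n
  recurrence-bound φ D e φ-var φ-app (app c ts) (cc , cts) = begin
    φ (app c ts)                                     ≤⟨ φ-app c ts cc cts ⟩
    sumFin (arity c) (φ ∘ ts) + D * Q                ≤⟨ +-monoˡ-≤ (D * Q) (sumFin-mono (arity c) arg-bound) ⟩
    sumFin (arity c) (λ i → D * Q * ∣ ts i ∣) + D * Q ≡⟨ cong (_+ D * Q) (sumFin-distribˡ-* (arity c) (D * Q) (∣_∣ ∘ ts)) ⟩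
    D * Q * S + D * Q                                ≡⟨ factor D Q S ⟩
    D * (Q + S * Q)                                  ∎
    where
    open ≤-Reasoning
    Q : ℕ
    Q = ∣ app c ts ∣ ^ e
    S : ℕ
    S = sumFin (arity c) (∣_∣ ∘ ts)
    factor : ∀ d q s → d * q * s + d * q ≡ d * (q + s * q)
    factor = solve-∀
    swap : ∀ d n q → d * (n * q) ≡ d * q * n
    swap = solve-∀
    arg-bound : ∀ i → φ (ts i) ≤ D * Q * ∣ ts i ∣
    arg-bound i = begin
      φ (ts i)                      ≤⟨ recurrence-bound φ D e φ-var φ-app (ts i) (cts i) ⟩
      D * (∣ ts i ∣ * ∣ ts i ∣ ^ e) ≤⟨ *-monoʳ-≤ D (*-monoʳ-≤ ∣ ts i ∣ (^-monoˡ-≤ e (∣arg∣≤∣app∣ c ts i))) ⟩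
      D * (∣ ts i ∣ * Q)            ≡⟨ swap D ∣ ts i ∣ Q ⟩
      D * Q * ∣ ts i ∣              ∎

  constructorDegree-unit : ∀ {k} (𝒜 : MatrixInterpretation k) →
                           ConstructorMatrices≤ 𝒜 unitMatrix → ConstructorDegree 𝒜 1
  constructorDegree-unit {k} 𝒜 𝒜≤I = V , λ t ct j →
    recurrence-bound (λ t → [ 𝒜 ]⟦ t ⟧ j) V 0 (λ _ → refl) (coordinate-recurrence j) t ct
    where
    V : ℕ
    V = maxFin size (λ f → maxFin k (vec 𝒜 f))
    coordinate-recurrence : ∀ j c ts → Constructor R c → (∀ i → ConstructorTerm R (ts i)) →
      [ 𝒜 ]⟦ app c ts ⟧ j ≤ sumFin (arity c) (λ i → [ 𝒜 ]⟦ ts i ⟧ j) + V * 1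
    coordinate-recurrence j c ts cc _ = +-mono-≤
      (sumFin-mono (arity c) λ i →
        ≤-trans (sumFin-mono k (λ l → *-monoˡ-≤ _ (𝒜≤I c cc i j l)))
                (≤-reflexive (unitMatrix-*ᵥ [ 𝒜 ]⟦ ts i ⟧ j)))
      (≤-trans (≤-trans (term≤maxFin k (vec 𝒜 c) j) (term≤maxFin size _ c))
               (≤-reflexive (sym (*-identityʳ V))))

  basicDegree : ∀ {k} (𝒜 : MatrixInterpretation k) e → ConstructorDegree 𝒜 e → BasicDegree 𝒜 R e
  basicDegree {k} 𝒜 e (C , bound) = G , basic-bound
    where
    rowSum : Sym → Fin k → ℕ
    rowSum f j = sumFin (arity f) (λ i → sumFin k (mat 𝒜 f i j))
    G : ℕ
    G = maxFin size (λ f → maxFin k (λ j → rowSum f j * C + vec 𝒜 f j))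
    factor : ∀ s c v q → s * (c * q) + v * q ≡ (s * c + v) * q
    factor = solve-∀
    basic-bound : ∀ t → Basic R t → ∀ j → [ 𝒜 ]⟦ t ⟧ j ≤ G * ∣ t ∣ ^ e
    basic-bound (app f ts) (_ , cts) j = begin
      sumFin (arity f) (λ i → (mat 𝒜 f i *ᵥ [ 𝒜 ]⟦ ts i ⟧) j) + vec 𝒜 f j
        ≤⟨ +-mono-≤ (sumFin-mono (arity f) (λ i → sumFin-*-≤ k (λ _ → ≤-refl) (arg-bound i)))
                    (m≤m*n (vec 𝒜 f j) Q {{m^n≢0 _ e}}) ⟩
      sumFin (arity f) (λ i → sumFin k (mat 𝒜 f i j) * (C * Q)) + vec 𝒜 f j * Q
        ≡⟨ cong (_+ vec 𝒜 f j * Q) (sumFin-distribʳ-* (arity f) (C * Q) _) ⟩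
      rowSum f j * (C * Q) + vec 𝒜 f j * Q
        ≡⟨ factor (rowSum f j) C (vec 𝒜 f j) Q ⟩
      (rowSum f j * C + vec 𝒜 f j) * Q
        ≤⟨ *-monoˡ-≤ Q (≤-trans (term≤maxFin k _ j) (term≤maxFin size _ f)) ⟩
      G * Q ∎
      where
      open ≤-Reasoning
      Q : ℕ
      Q = ∣ app f ts ∣ ^ e
      arg-bound : ∀ i l → [ 𝒜 ]⟦ ts i ⟧ l ≤ C * Q
      arg-bound i l = ≤-trans (bound (ts i) (cts i) l) (*-monoʳ-≤ C (^-monoˡ-≤ e (∣arg∣≤∣app∣ f ts i)))

  tailInterpretation : ∀ {k} → MatrixInterpretation (suc k) → MatrixInterpretation k
  tailInterpretation 𝒜 = record
    { mat = λ f i → tailMatrix (mat 𝒜 f i)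
    ; vec = λ f → vec 𝒜 f ∘ fs
    }

  ⟦⟧-tail : ∀ {k} (𝒜 : MatrixInterpretation (suc k)) →
    (∀ c → Constructor R c → ∀ i j → mat 𝒜 c i (fs j) fz ≡ 0) →
    ∀ t → ConstructorTerm R t → ∀ j → [ tailInterpretation 𝒜 ]⟦ t ⟧ j ≡ [ 𝒜 ]⟦ t ⟧ (fs j)
  ⟦⟧-tail 𝒜 col₀≡0 (var x) _ j = refl
  ⟦⟧-tail {k} 𝒜 col₀≡0 (app c ts) (cc , cts) j =
    cong (_+ vec 𝒜 c (fs j)) (sumFin-cong (arity c) arg)
    where
    open ≡-Reasoning
    arg : ∀ i → (tailMatrix (mat 𝒜 c i) *ᵥ [ tailInterpretation 𝒜 ]⟦ ts i ⟧) j
              ≡ (mat 𝒜 c i *ᵥ [ 𝒜 ]⟦ ts i ⟧) (fs j)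
    arg i = begin
      sumFin k (λ l → mat 𝒜 c i (fs j) (fs l) * [ tailInterpretation 𝒜 ]⟦ ts i ⟧ l)
        ≡⟨ sumFin-cong k (λ l → cong (mat 𝒜 c i (fs j) (fs l) *_) (⟦⟧-tail 𝒜 col₀≡0 (ts i) (cts i) l)) ⟩
      rest
        ≡⟨ cong (λ m → m * [ 𝒜 ]⟦ ts i ⟧ fz + rest) (sym (col₀≡0 c cc i j)) ⟩
      mat 𝒜 c i (fs j) fz * [ 𝒜 ]⟦ ts i ⟧ fz + rest ∎
      where
      rest : ℕ
      rest = sumFin k (λ l → mat 𝒜 c i (fs j) (fs l) * [ 𝒜 ]⟦ ts i ⟧ (fs l))

  head-recurrence : ∀ {k} (𝒜 : MatrixInterpretation (suc k)) (M : Matrix (suc k)) →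
    ConstructorMatrices≤ 𝒜 M → ∀ C e →
    (∀ t → ConstructorTerm R t → ∀ j → [ 𝒜 ]⟦ t ⟧ (fs j) ≤ C * ∣ t ∣ ^ e) →
    Σ ℕ λ D → ∀ c ts → Constructor R c → (∀ i → ConstructorTerm R (ts i)) →
      [ 𝒜 ]⟦ app c ts ⟧ fz ≤ M fz fz * sumFin (arity c) (λ i → [ 𝒜 ]⟦ ts i ⟧ fz) + D * ∣ app c ts ∣ ^ e
  head-recurrence {k} 𝒜 M 𝒜≤M C e tail-bound = maxArity * (R₀ * C) + V₀ , recurrence
    where
    R₀ : ℕ
    R₀ = sumFin k (M fz ∘ fs)
    V₀ : ℕ
    V₀ = maxFin size (λ f → vec 𝒜 f fz)
    reassoc : ∀ a m r c v q → a + m * (r * (c * q)) + v * q ≡ a + (m * (r * c) + v) * q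
    reassoc = solve-∀
    recurrence : ∀ c ts → Constructor R c → (∀ i → ConstructorTerm R (ts i)) →
      [ 𝒜 ]⟦ app c ts ⟧ fz ≤ M fz fz * sumFin (arity c) (λ i → [ 𝒜 ]⟦ ts i ⟧ fz)
                               + (maxArity * (R₀ * C) + V₀) * ∣ app c ts ∣ ^ e
    recurrence c ts cc cts = begin
      sumFin (arity c) (λ i → (mat 𝒜 c i *ᵥ [ 𝒜 ]⟦ ts i ⟧) fz) + vec 𝒜 c fz
        ≤⟨ +-mono-≤ (sumFin-mono (arity c) row-bound) vec-bound ⟩
      sumFin (arity c) (λ i → M fz fz * x i + R₀ * (C * Q)) + V₀ * Q
        ≡⟨ cong (_+ V₀ * Q) (trans (sumFin-distrib-+ (arity c) _ _)
                                   (cong (_+ sumFin (arity c) (λ _ → R₀ * (C * Q))) (sumFin-distribˡ-* (arity c) (M fz fz) x))) ⟩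
      M fz fz * sumFin (arity c) x + sumFin (arity c) (λ _ → R₀ * (C * Q)) + V₀ * Q
        ≤⟨ +-monoˡ-≤ (V₀ * Q) (+-monoʳ-≤ _ (sumFin-arity-const c _)) ⟩
      M fz fz * sumFin (arity c) x + maxArity * (R₀ * (C * Q)) + V₀ * Q
        ≡⟨ reassoc _ maxArity R₀ C V₀ Q ⟩
      M fz fz * sumFin (arity c) x + (maxArity * (R₀ * C) + V₀) * Q ∎
      where
      open ≤-Reasoning
      Q : ℕ
      Q = ∣ app c ts ∣ ^ e
      x : Fin (arity c) → ℕ
      x i = [ 𝒜 ]⟦ ts i ⟧ fz
      row-bound : ∀ i → (mat 𝒜 c i *ᵥ [ 𝒜 ]⟦ ts i ⟧) fz ≤ M fz fz * x i + R₀ * (C * Q)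
      row-bound i = +-mono-≤ (*-monoˡ-≤ (x i) (𝒜≤M c cc i fz fz))
        (sumFin-*-≤ k (λ l → 𝒜≤M c cc i fz (fs l)) λ l →
          ≤-trans (tail-bound (ts i) (cts i) l) (*-monoʳ-≤ C (^-monoˡ-≤ e (∣arg∣≤∣app∣ c ts i))))
      vec-bound : vec 𝒜 c fz ≤ V₀ * Q
      vec-bound = ≤-trans (term≤maxFin size (λ f → vec 𝒜 f fz) c) (m≤m*n V₀ Q {{m^n≢0 _ e}})

  constructorDegree-head-tail : ∀ {k} (𝒜 : MatrixInterpretation (suc k)) {D C e} →
    (∀ t → ConstructorTerm R t → [ 𝒜 ]⟦ t ⟧ fz ≤ D * ∣ t ∣ ^ e) →
    (∀ t → ConstructorTerm R t → ∀ j → [ 𝒜 ]⟦ t ⟧ (fs j) ≤ C * ∣ t ∣ ^ e) →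
    ConstructorDegree 𝒜 e
  constructorDegree-head-tail 𝒜 {D} {C} head-bound tail-bound = D + C , λ where
    t ct fz     → ≤-trans (head-bound t ct) (*-monoˡ-≤ _ (m≤m+n D C))
    t ct (fs j) → ≤-trans (tail-bound t ct j) (*-monoˡ-≤ _ (m≤n+m C D))

  constructorDegree-step : ∀ {k} (𝒜 : MatrixInterpretation (suc k)) (M : Matrix (suc k)) →
    ConstructorMatrices≤ 𝒜 M → UTCM M →
    ConstructorDegree (tailInterpretation 𝒜) (diagOnes (tailMatrix M)) →
    ConstructorDegree 𝒜 (diagOnes M)
  constructorDegree-step 𝒜 M 𝒜≤M (lower , diag) (C , tail-degree) =
    by-diagonal (n≤1⇒n≡0∨n≡1 (diag fz))
    where
    e : ℕ
    e = diagOnes (tailMatrix M)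

    col₀≡0 : ∀ c → Constructor R c → ∀ i j → mat 𝒜 c i (fs j) fz ≡ 0
    col₀≡0 c cc i j = n≤0⇒n≡0 (≤-trans (𝒜≤M c cc i (fs j) fz) (≤-reflexive (lower (fs j) fz z<s)))

    tail-bound : ∀ t → ConstructorTerm R t → ∀ j → [ 𝒜 ]⟦ t ⟧ (fs j) ≤ C * ∣ t ∣ ^ e
    tail-bound t ct j = subst (_≤ C * ∣ t ∣ ^ e) (⟦⟧-tail 𝒜 col₀≡0 t ct j) (tail-degree t ct j)

    D : ℕ
    D = proj₁ (head-recurrence 𝒜 M 𝒜≤M C e tail-bound)

    head-recurrence-at : ∀ {m} → M fz fz ≡ m → ∀ c ts → Constructor R c → (∀ i → ConstructorTerm R (ts i)) →
      [ 𝒜 ]⟦ app c ts ⟧ fz ≤ m * sumFin (arity c) (λ i → [ 𝒜 ]⟦ ts i ⟧ fz) + D * ∣ app c ts ∣ ^ e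
    head-recurrence-at M₀₀≡m c ts cc cts =
      subst (λ m → _ ≤ m * _ + _) M₀₀≡m (proj₂ (head-recurrence 𝒜 M 𝒜≤M C e tail-bound) c ts cc cts)

    by-diagonal : (M fz fz ≡ 0) ⊎ (M fz fz ≡ 1) → ConstructorDegree 𝒜 (diagOnes M)
    by-diagonal (inj₁ M₀₀≡0) =
      subst (ConstructorDegree 𝒜) (sym (diagOnes-tail-0 M M₀₀≡0))
        (constructorDegree-head-tail 𝒜 {D} {C} {e} head-bound tail-bound)
      where
      head-bound : ∀ t → ConstructorTerm R t → [ 𝒜 ]⟦ t ⟧ fz ≤ D * ∣ t ∣ ^ e
      head-bound (var x)    _          = z≤n
      head-bound (app c ts) (cc , cts) = head-recurrence-at M₀₀≡0 c ts cc cts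
    by-diagonal (inj₂ M₀₀≡1) =
      subst (ConstructorDegree 𝒜) (sym (diagOnes-tail-1 M M₀₀≡1))
        (constructorDegree-head-tail 𝒜 {D} {C} {suc e}
          (recurrence-bound (λ t → [ 𝒜 ]⟦ t ⟧ fz) D e (λ _ → refl) head-recurrence₁) tail-bound′)
      where
      head-recurrence₁ : ∀ c ts → Constructor R c → (∀ i → ConstructorTerm R (ts i)) →
        [ 𝒜 ]⟦ app c ts ⟧ fz ≤ sumFin (arity c) (λ i → [ 𝒜 ]⟦ ts i ⟧ fz) + D * ∣ app c ts ∣ ^ e
      head-recurrence₁ c ts cc cts =
        ≤-trans (head-recurrence-at M₀₀≡1 c ts cc cts) (≤-reflexive (cong (_+ D * ∣ app c ts ∣ ^ e) (*-identityˡ _)))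
      tail-bound′ : ∀ t → ConstructorTerm R t → ∀ j → [ 𝒜 ]⟦ t ⟧ (fs j) ≤ C * ∣ t ∣ ^ suc e
      tail-bound′ t ct j =
        ≤-trans (tail-bound t ct j) (*-monoʳ-≤ C (^-monoʳ-≤ ∣ t ∣ {{∣∣-nonZero t}} (n≤1+n e)))

  constructorDegree-diagOnes : ∀ {k} (𝒜 : MatrixInterpretation k) (M : Matrix k) →
    ConstructorMatrices≤ 𝒜 M → UTCM M → ConstructorDegree 𝒜 (diagOnes M)
  constructorDegree-diagOnes {zero}  𝒜 M _   _      = 0 , λ _ _ ()
  constructorDegree-diagOnes {suc k} 𝒜 M 𝒜≤M M-utcm =
    constructorDegree-step 𝒜 M 𝒜≤M M-utcm
      (constructorDegree-diagOnes (tailInterpretation 𝒜) (tailMatrix M)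
        (λ f cf i j l → 𝒜≤M f cf i (fs j) (fs l)) (UTCM-tail M-utcm))

  module _ {k} (𝒜 : MatrixInterpretation k) where
    -- The entries of maxConstrMatrix are maxima of a where-bound function; this
    -- names it, so that lemmas can case on Defined? R f inside it.
    constructorEntry : Fin k → Fin k → Sym → ℕ
    constructorEntry j l = proj₁ {B = λ g → maxConstrMatrix 𝒜 R j l ≡ maxFin size g} (_ , refl)

    mat≤constructorEntry : ∀ f → Constructor R f → ∀ i j l → mat 𝒜 f i j l ≤ constructorEntry j l f
    mat≤constructorEntry f cf i j l with Defined? R f
    ... | yes df = ⊥-elim (cf df)
    ... | no  _  = term≤maxFin (arity f) (λ i → mat 𝒜 f i j l) i

    constructorEntry≤ : ∀ {j l b} → (∀ f → Constructor R f → ∀ i → mat 𝒜 f i j l ≤ b) →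
                        ∀ f → constructorEntry j l f ≤ b
    constructorEntry≤ {j} {l} {b} mat≤b f with Defined? R f
    ... | yes _  = z≤n
    ... | no  cf = maxFin-lub (arity f) (λ i → mat 𝒜 f i j l) b (mat≤b f cf)

    maxConstrMatrix-bounds : ConstructorMatrices≤ 𝒜 (maxConstrMatrix 𝒜 R)
    maxConstrMatrix-bounds f cf i j l =
      ≤-trans (mat≤constructorEntry f cf i j l) (term≤maxFin size (constructorEntry j l) f)

    maxConstrMatrix-≤ : ∀ {j l b} → (∀ f → Constructor R f → ∀ i → mat 𝒜 f i j l ≤ b) →
                        maxConstrMatrix 𝒜 R j l ≤ b
    maxConstrMatrix-≤ {j} {l} {b} mat≤b = maxFin-lub size (constructorEntry j l) b (constructorEntry≤ mat≤b)

    maxConstrMatrix-UTCM : RMI 𝒜 R → UTCM (maxConstrMatrix 𝒜 R)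
    maxConstrMatrix-UTCM rmi =
      (λ j l l<j → n≤0⇒n≡0 (maxConstrMatrix-≤ (λ f cf i → ≤-reflexive (proj₁ (rmi f cf i) j l l<j)))) ,
      (λ j → maxConstrMatrix-≤ (λ f cf i → proj₂ (rmi f cf i) j))

theorem9 : (Σs : Signature) (R : Terms.TRS Σs) (k : ℕ)
    (𝒜 : Interpretations.MatrixInterpretation Σs k) →
    Interpretations.RMI Σs 𝒜 R →
    Interpretations.BasicDegree Σs 𝒜 R
        (diagOnes (Interpretations.maxConstrMatrix Σs 𝒜 R))
    × ((∀ j l → Interpretations.maxConstrMatrix Σs 𝒜 R j l ≡ unitMatrix j l) →
       Interpretations.BasicDegree Σs 𝒜 R 1)
theorem9 Σs R k 𝒜 rmi = degree-diagOnes , degree-one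
  where
  open Interpretations Σs using (maxConstrMatrix; BasicDegree)
  open ConstructorBounds R

  M : Matrix k
  M = maxConstrMatrix 𝒜 R

  degree-diagOnes : BasicDegree 𝒜 R (diagOnes M)
  degree-diagOnes = basicDegree 𝒜 (diagOnes M)
    (constructorDegree-diagOnes 𝒜 M (maxConstrMatrix-bounds 𝒜) (maxConstrMatrix-UTCM 𝒜 rmi))

  degree-one : (∀ j l → M j l ≡ unitMatrix j l) → BasicDegree 𝒜 R 1
  degree-one M≡I = basicDegree 𝒜 1 (constructorDegree-unit 𝒜 λ f cf i j l →
    ≤-trans (maxConstrMatrix-bounds 𝒜 f cf i j l) (≤-reflexive (M≡I j l)))
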